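{- Let $k$ be a positive integer and let $G$ be a graph with a partition $(V_1,\dots,V_m)$ of $V(G)$. If for every $i$ and every $v\in V_i$, the vertex $v$ has at most $\min\{k-1,|V_i|-k\}$ neighbours outside $V_i$, then $G$ has an independent transversal with respect to $(V_1,\dots,V_m)$.
   Context: An independent transversal of $G$ with respect to a vertex partition $(V_1,\dots,V_m)$ is an independent set $\{v_1,\dots,v_m\}$ of $G$ with $v_i\in V_i$ for each $i$. -}

module Defs where

open import Data.Nat using (ℕ; suc; _+_; _≤_)
open import Data.Fin using (Fin; _≟_)
open import Data.Bool using (Bool; true; false; _∧_; not; T)
open import Data.List using (List; length; filterᵇ; allFin)
open import Data.Product using (Σ; ∃; _×_)
open import Relation.Nullary using (¬_; does)
open import Relation.Binary.PropositionalEquality using (_≡_; _≢_)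

record Graph (n : ℕ) : Set where
  field
    adj   : Fin n → Fin n → Bool
    sym   : ∀ u v → adj u v ≡ adj v u
    irrefl : ∀ v → adj v v ≡ false
open Graph public

record Partition (n m : ℕ) : Set where
  field
    cls      : Fin n → Fin m
    nonempty : ∀ i → ∃ λ v → cls v ≡ i
open Partition public

partSize : ∀ {n m} → Partition n m → Fin m → ℕ
partSize {n} P i = length (filterᵇ (λ v → does (cls P v ≟ i)) (allFin n))

outDeg : ∀ {n m} → Graph n → Partition n m → Fin n → ℕ
outDeg {n} G P v =
  length (filterᵇ (λ u → adj G v u ∧ not (does (cls P u ≟ cls P v))) (allFin n))

IndependentTransversal : ∀ {n m} → Graph n → Partition n m → Set
IndependentTransversal {n} {m} G P =
  Σ (Fin m → Fin n) λ t →
    (∀ i → cls P (t i) ≡ i) × (∀ i j → adj G (t i) (t j) ≡ false)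

module Submission where

-- Write deg v for the number of neighbours of v outside its own part and V(v)
-- for the part of v.  The general result proved here (independent-transversal)
-- is a Haxell-type theorem: if deg x + deg y < |V(y)| for all vertices x, y,
-- then G has an independent transversal.  lemma8 follows at once, since its
-- hypotheses give deg x + 1 ≤ k and deg y + k ≤ |V(y)|.
--
-- The transversal is built one part at a time.  Given a partial independent
-- transversal M that misses the part V_r, we grow an alternating sequence
-- (x₁,y₁),…,(x_t,y_t): each yⱼ is chosen by M and adjacent to xⱼ, and each xⱼ
-- lies in V_r or in the part of an earlier y, without being adjacent to any
-- earlier x or y.  Counting (alternating-bound) shows that the parts met so far
-- always contain such an undominated candidate x.  If x has a neighbour chosen
-- by M the sequence is extended; otherwise x replaces the choice in its part
-- (if that part is V_r we are done) and the sequence is cut back.  The list of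
-- M-degrees of the xⱼ decreases lexicographically, which is encoded as a
-- natural number (Potential) to get termination.

open import Defs hiding (sym)
open import Data.Nat using (ℕ; suc; _+_; _≤_)
open import Data.Fin using (Fin)
open import Data.Product using (_×_)

open import Data.Bool using (Bool; true; false; _∧_; _∨_; not; if_then_else_)
open import Data.Empty using (⊥; ⊥-elim)
open import Data.Fin using (_≟_)
open import Data.List using (List; []; _∷_; _++_; length; map; filterᵇ; allFin)
open import Data.List.Properties using (length-++; length-map; map-++; length-tabulate)
open import Data.List.Membership.Propositional using (_∈_)
open import Data.List.Membership.Propositional.Properties using (∈-allFin)
open import Data.List.Relation.Unary.All as All using (All; []; _∷_)
open import Data.List.Relation.Unary.Any using (here; there)
open import Data.Maybe using (Maybe; just; nothing)
open import Data.Maybe.Properties using (just-injective; ≡-dec)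
open import Data.Nat using (zero; z≤n; s≤s; _<_; _*_; _^_)
open import Data.Nat.Properties hiding (_≟_)
open import Data.Nat.Induction using (<-wellFounded)
open import Data.Nat.Tactic.RingSolver using (solve-∀)
open import Data.Product using (Σ; ∃; _,_; proj₁; proj₂)
open import Data.Sum using (_⊎_; inj₁; inj₂)
open import Induction.WellFounded using (Acc; acc)
open import Relation.Nullary using (Dec; yes; no; does)
open import Relation.Nullary.Decidable using (dec-true; dec-false)
open import Relation.Binary.PropositionalEquality
  using (_≡_; _≢_; refl; sym; trans; cong; subst)

does-true : ∀ {A : Set} (d : Dec A) → does d ≡ true → A
does-true (yes a) _ = a

does-≟-sym : ∀ {j} (a b : Fin j) → does (a ≟ b) ≡ does (b ≟ a)
does-≟-sym a b with a ≟ b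
... | yes a≡b = sym (dec-true (b ≟ a) (sym a≡b))
... | no a≢b  = sym (dec-false (b ≟ a) (λ b≡a → a≢b (sym b≡a)))

contradictory : ∀ {a} → a ≡ true → a ≡ false → ⊥
contradictory refl ()

∧-true : ∀ {a b} → a ≡ true → b ≡ true → a ∧ b ≡ true
∧-true refl refl = refl

∧-split : ∀ a b → a ∧ b ≡ true → a ≡ true × b ≡ true
∧-split true true _ = refl , refl

∨-split : ∀ a b → a ∨ b ≡ true → a ≡ true ⊎ b ≡ true
∨-split true  _ _ = inj₁ refl
∨-split false _ e = inj₂ e

-- Cutting a list after position |D| + 1 frees that many positions of a budget.
length-cut : ∀ {A : Set} (D : List A) q L₀ b → length (D ++ q ∷ L₀) + b ≡ length L₀ + (b + suc (length D))
length-cut D q L₀ b = trans (cong (_+ b) (length-++ D)) (regroup (length D) (length L₀) b)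
  where
    regroup : ∀ d l c → d + suc l + c ≡ l + (c + suc d)
    regroup = solve-∀

module Counting {A : Set} where

  count : (A → Bool) → List A → ℕ
  count p xs = length (filterᵇ p xs)

  count≤length : ∀ p xs → count p xs ≤ length xs
  count≤length p [] = z≤n
  count≤length p (x ∷ xs) with p x
  ... | true  = s≤s (count≤length p xs)
  ... | false = m≤n⇒m≤1+n (count≤length p xs)

  count-mono : ∀ {p q : A → Bool} → (∀ u → p u ≡ true → q u ≡ true) →
               ∀ xs → count p xs ≤ count q xs
  count-mono p⇒q [] = z≤n
  count-mono {p} {q} p⇒q (x ∷ xs) with p x in px | q x in qx
  ... | true  | true  = s≤s (count-mono p⇒q xs)
  ... | true  | false with () ← trans (sym (p⇒q x px)) qx
  ... | false | true  = m≤n⇒m≤1+n (count-mono p⇒q xs)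
  ... | false | false = count-mono p⇒q xs

  count-strict : ∀ {p q : A → Bool} → (∀ u → p u ≡ true → q u ≡ true) →
                 ∀ {w xs} → w ∈ xs → p w ≡ false → q w ≡ true → count p xs < count q xs
  count-strict {p} {q} p⇒q {xs = x ∷ xs} (here refl) pw qw
    rewrite pw | qw = s≤s (count-mono p⇒q xs)
  count-strict {p} {q} p⇒q {xs = x ∷ xs} (there w∈xs) pw qw with p x in px | q x in qx
  ... | true  | true  = s≤s (count-strict p⇒q w∈xs pw qw)
  ... | true  | false with () ← trans (sym (p⇒q x px)) qx
  ... | false | true  = m≤n⇒m≤1+n (count-strict p⇒q w∈xs pw qw)
  ... | false | false = count-strict p⇒q w∈xs pw qw

  count-∨ : ∀ (p q : A → Bool) xs → count (λ u → p u ∨ q u) xs ≤ count p xs + count q xs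
  count-∨ p q [] = z≤n
  count-∨ p q (x ∷ xs) with p x | q x
  ... | true  | true  = s≤s (≤-trans (count-∨ p q xs) (+-monoʳ-≤ (count p xs) (n≤1+n _)))
  ... | true  | false = s≤s (count-∨ p q xs)
  ... | false | true  = ≤-trans (s≤s (count-∨ p q xs)) (≤-reflexive (sym (+-suc _ _)))
  ... | false | false = count-∨ p q xs

  count-∨-disjoint : ∀ (p q : A → Bool) → (∀ u → p u ≡ true → q u ≡ false) →
                     ∀ xs → count (λ u → p u ∨ q u) xs ≡ count p xs + count q xs
  count-∨-disjoint p q disj [] = refl
  count-∨-disjoint p q disj (x ∷ xs) with p x in px | q x in qx
  ... | true  | true  with () ← trans (sym (disj x px)) qx
  ... | true  | false = cong suc (count-∨-disjoint p q disj xs)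
  ... | false | true  = trans (cong suc (count-∨-disjoint p q disj xs)) (sym (+-suc _ _))
  ... | false | false = count-∨-disjoint p q disj xs

  count-witness : ∀ p xs → 0 < count p xs → ∃ λ u → p u ≡ true
  count-witness p (x ∷ xs) pos with p x in px
  ... | true  = x , px
  ... | false = count-witness p xs pos

-- Lists of digits below b, least significant first, read in base b + 1.  A list
-- ds together with r further free positions gets the potential (1 + value ds)·base^r.
-- Appending a digit while using up a free position, and cutting a list back
-- after lowering one digit without raising the later ones, both decrease it.
module Potential (b : ℕ) where

  base : ℕ
  base = suc b

  value : List ℕ → ℕ
  value []       = 0
  value (d ∷ ds) = value ds * base + d

  potential : List ℕ → ℕ → ℕ
  potential ds r = suc (value ds) * base ^ r

  potential-push : ∀ d ds r → d < b → potential (d ∷ ds) r < potential ds (suc r)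
  potential-push d ds r d<b = begin-strict
      suc (value ds * base + d) * base ^ r
    <⟨ *-monoˡ-< (base ^ r) {{m^n≢0 base r}} top-digit ⟩
      suc (value ds) * base * base ^ r
    ≡⟨ *-assoc (suc (value ds)) base (base ^ r) ⟩
      suc (value ds) * (base * base ^ r) ∎
    where
      open ≤-Reasoning
      top-digit : suc (value ds * base + d) < suc (value ds) * base
      top-digit = begin-strict
          suc (value ds * base + d)  ≡⟨ sym (+-suc (value ds * base) d) ⟩
          value ds * base + suc d    <⟨ +-monoʳ-< (value ds * base) (s≤s d<b) ⟩
          value ds * base + base     ≡⟨ +-comm (value ds * base) base ⟩
          suc (value ds) * base      ∎

  value-mono : ∀ {X : Set} (f g : X → ℕ) xs → All (λ x → f x ≤ g x) xs →
               value (map f xs) ≤ value (map g xs)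
  value-mono f g [] [] = z≤n
  value-mono f g (x ∷ xs) (fx≤gx ∷ rest) =
    +-mono-≤ (*-monoˡ-≤ base (value-mono f g xs rest)) fx≤gx

  value-< : ∀ {d d' ds ds'} → d' < d → value ds' ≤ value ds → value (d' ∷ ds') < value (d ∷ ds)
  value-< {d} {d'} {ds} {ds'} d'<d le = begin-strict
      value ds' * base + d'  <⟨ +-mono-≤-< (*-monoˡ-≤ base le) d'<d ⟩
      value ds * base + d    ∎
    where open ≤-Reasoning

  value-shift : ∀ cs ds → value ds * base ^ length cs ≤ value (cs ++ ds)
  value-shift [] ds = ≤-reflexive (*-identityʳ (value ds))
  value-shift (c ∷ cs) ds = begin
      value ds * (base * base ^ length cs)
    ≡⟨ cong (value ds *_) (*-comm base (base ^ length cs)) ⟩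
      value ds * (base ^ length cs * base)
    ≡⟨ sym (*-assoc (value ds) (base ^ length cs) base) ⟩
      value ds * base ^ length cs * base
    ≤⟨ *-monoˡ-≤ base (value-shift cs ds) ⟩
      value (cs ++ ds) * base
    ≤⟨ m≤m+n _ c ⟩
      value (cs ++ ds) * base + c ∎
    where open ≤-Reasoning

  potential-cut : ∀ cs {ds ds'} r → value ds' < value ds →
                  potential ds' (r + length cs) < potential (cs ++ ds) r
  potential-cut cs {ds} {ds'} r lt = begin-strict
      suc (value ds') * base ^ (r + length cs)
    ≤⟨ *-monoˡ-≤ (base ^ (r + length cs)) lt ⟩
      value ds * base ^ (r + length cs)
    ≡⟨ cong (value ds *_) (trans (^-distribˡ-+-* base r (length cs)) (*-comm (base ^ r) _)) ⟩
      value ds * (base ^ length cs * base ^ r)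
    ≡⟨ sym (*-assoc (value ds) _ _) ⟩
      value ds * base ^ length cs * base ^ r
    ≤⟨ *-monoˡ-≤ (base ^ r) (value-shift cs ds) ⟩
      value (cs ++ ds) * base ^ r
    <⟨ *-monoˡ-< (base ^ r) {{m^n≢0 base r}} (n<1+n (value (cs ++ ds))) ⟩
      suc (value (cs ++ ds)) * base ^ r ∎
    where open ≤-Reasoning

module Transversals {n m : ℕ} (G : Graph n) (P : Partition n m) where
  open Counting

  Vertex : Set
  Vertex = Fin n

  part : Vertex → Fin m
  part = cls P

  cross : Vertex → Vertex → Bool
  cross x u = adj G x u ∧ not (does (part u ≟ part x))

  deg : Vertex → ℕ
  deg = outDeg G P

  cross-sym : ∀ x u → cross x u ≡ cross u x
  cross-sym x u rewrite Graph.sym G x u | does-≟-sym (part u) (part x) = refl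

  cross-irrefl : ∀ x → cross x x ≡ false
  cross-irrefl x rewrite irrefl G x = refl

  cross-false : ∀ x u → cross x u ≡ false → part u ≢ part x → adj G x u ≡ false
  cross-false x u no-cross differ rewrite dec-false (part u ≟ part x) differ
    with adj G x u | no-cross
  ... | false | _ = refl

  countV : (Vertex → Bool) → ℕ
  countV p = count p (allFin n)

  countV≤n : ∀ p → countV p ≤ n
  countV≤n p = ≤-trans (count≤length p (allFin n)) (≤-reflexive (length-tabulate (λ v → v)))

  HaxellCondition : Set
  HaxellCondition = ∀ x y → deg x + deg y < partSize P (part y)

  PartialMap : Set
  PartialMap = Fin m → Maybe Vertex

  chosen : PartialMap → Vertex → Bool
  chosen M u = does (≡-dec _≟_ (M (part u)) (just u))

  chosen-sound : ∀ M u → chosen M u ≡ true → M (part u) ≡ just u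
  chosen-sound M u = does-true (≡-dec _≟_ (M (part u)) (just u))

  chosen-complete : ∀ M u → M (part u) ≡ just u → chosen M u ≡ true
  chosen-complete M u = dec-true (≡-dec _≟_ (M (part u)) (just u))

  chosen-unique : ∀ M {u w} → chosen M u ≡ true → chosen M w ≡ true → part u ≡ part w → u ≡ w
  chosen-unique M {u} {w} cu cw same =
    just-injective (trans (sym (chosen-sound M u cu)) (trans (cong M same) (chosen-sound M w cw)))

  record IsPartialIT (M : PartialMap) : Set where
    field
      inPart      : ∀ i w → M i ≡ just w → part w ≡ i
      independent : ∀ u w → chosen M u ≡ true → chosen M w ≡ true → cross u w ≡ false

  emptyMap : PartialMap
  emptyMap _ = nothing

  empty-IsPartialIT : IsPartialIT emptyMap
  empty-IsPartialIT = record { inPart = λ _ _ () ; independent = λ { _ _ () _ } }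

  Assigned : PartialMap → Fin m → Set
  Assigned M i = ∃ λ w → M i ≡ just w

  Extends : PartialMap → PartialMap → Set
  Extends M₀ M = ∀ i → Assigned M₀ i → Assigned M i

  place : PartialMap → Vertex → PartialMap
  place M x i = if does (i ≟ part x) then just x else M i

  place-at : ∀ M x → place M x (part x) ≡ just x
  place-at M x rewrite dec-true (part x ≟ part x) refl = refl

  place-off : ∀ M x i → i ≢ part x → place M x i ≡ M i
  place-off M x i ne rewrite dec-false (i ≟ part x) ne = refl

  place-extends : ∀ {M₀ M} x → Extends M₀ M → Extends M₀ (place M x)
  place-extends x ext i assigned with i ≟ part x
  ... | yes _ = x , refl
  ... | no _  = ext i assigned

  chosen-place : ∀ M x u → chosen (place M x) u ≡ true →
                 u ≡ x ⊎ (chosen M u ≡ true × part u ≢ part x)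
  chosen-place M x u cu = by-part (part u ≟ part x)
    where
      placed : place M x (part u) ≡ just u
      placed = chosen-sound (place M x) u cu
      by-part : Dec (part u ≡ part x) → u ≡ x ⊎ (chosen M u ≡ true × part u ≢ part x)
      by-part (yes same) =
        inj₁ (just-injective (trans (sym placed) (trans (cong (place M x) same) (place-at M x))))
      by-part (no differ) =
        inj₂ (chosen-complete M u (trans (sym (place-off M x (part u) differ)) placed) , differ)

  chosen-place-keep : ∀ M x u → chosen M u ≡ true → part u ≢ part x → chosen (place M x) u ≡ true
  chosen-place-keep M x u cu differ =
    chosen-complete (place M x) u (trans (place-off M x (part u) differ) (chosen-sound M u cu))

  place-displaces : ∀ M x y → y ≢ x → part y ≡ part x → chosen (place M x) y ≡ false
  place-displaces M x y y≢x same with chosen (place M x) y in cy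
  ... | false = refl
  ... | true with chosen-place M x y cy
  ...   | inj₁ y≡x         = ⊥-elim (y≢x y≡x)
  ...   | inj₂ (_ , differ) = ⊥-elim (differ same)

  place-IsPartialIT : ∀ {M} x → IsPartialIT M → (∀ u → chosen M u ≡ true → cross x u ≡ false) →
                      IsPartialIT (place M x)
  IsPartialIT.inPart (place-IsPartialIT x pit isolated) i w placed with i ≟ part x
  ... | yes refl with placed
  ...   | refl = refl
  IsPartialIT.inPart (place-IsPartialIT x pit isolated) i w placed | no _ =
    IsPartialIT.inPart pit i w placed
  IsPartialIT.independent (place-IsPartialIT {M} x pit isolated) u w cu cw
    with chosen-place M x u cu | chosen-place M x w cw
  ... | inj₁ refl       | inj₁ refl       = cross-irrefl x
  ... | inj₁ refl       | inj₂ (cw' , _)  = isolated w cw'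
  ... | inj₂ (cu' , _)  | inj₁ refl       = trans (cross-sym u x) (isolated u cu')
  ... | inj₂ (cu' , _)  | inj₂ (cw' , _)  = IsPartialIT.independent pit u w cu' cw'

  mdeg : PartialMap → Vertex → ℕ
  mdeg M x = countV (λ u → cross x u ∧ chosen M u)

  mdeg-zero : ∀ M x → mdeg M x ≡ 0 → ∀ u → chosen M u ≡ true → cross x u ≡ false
  mdeg-zero M x none u cu with cross x u in xu
  ... | false = refl
  ... | true  = ⊥-elim (n≮0 (subst (countV (λ _ → false) <_) none
                  (count-strict (λ _ ()) (∈-allFin u) refl (∧-true xu cu))))

  place-neighbour : ∀ M x z → cross z x ≡ false →
                    ∀ u → (cross z u ∧ chosen (place M x) u) ≡ true → (cross z u ∧ chosen M u) ≡ true
  place-neighbour M x z zx u h with ∧-split (cross z u) _ h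
  ... | zu , cu with chosen-place M x u cu
  ...   | inj₁ refl     = ⊥-elim (contradictory zu zx)
  ...   | inj₂ (cu' , _) = ∧-true zu cu'

  mdeg-place-≤ : ∀ M x z → cross z x ≡ false → mdeg (place M x) z ≤ mdeg M z
  mdeg-place-≤ M x z zx = count-mono (place-neighbour M x z zx) (allFin n)

  mdeg-place-< : ∀ M x z y → cross z x ≡ false → chosen M y ≡ true → cross z y ≡ true →
                 part y ≡ part x → mdeg (place M x) z < mdeg M z
  mdeg-place-< M x z y zx cy zy same =
    count-strict (place-neighbour M x z zx) (∈-allFin y) displaced (∧-true zy cy)
    where
      y≢x : y ≢ x
      y≢x refl = contradictory zy zx
      displaced : (cross z y ∧ chosen (place M x) y) ≡ false
      displaced = subst (λ c → (c ∧ chosen (place M x) y) ≡ false) (sym zy)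
                    (place-displaces M x y y≢x same)

  module Augmentation (haxell : HaxellCondition) (r : Fin m) (M₀ : PartialMap) where

    Pair : Set
    Pair = Vertex × Vertex

    inParts : List Pair → Vertex → Bool
    inParts []            u = does (part u ≟ r)
    inParts ((x , y) ∷ L) u = does (part u ≟ part y) ∨ inParts L u

    dominated : List Pair → Vertex → Bool
    dominated []            u = false
    dominated ((x , y) ∷ L) u = cross x u ∨ cross y u ∨ dominated L u

    undominated-cons : ∀ x y L u → dominated ((x , y) ∷ L) u ≡ false →
                       cross x u ≡ false × cross y u ≡ false × dominated L u ≡ false
    undominated-cons x y L u undom with cross x u | cross y u | dominated L u | undom
    ... | false | false | false | _ = refl , refl , refl

    Candidate : List Pair → Vertex → Set
    Candidate L u = inParts L u ≡ true × dominated L u ≡ false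

    -- Alternating sequences, newest pair first.
    data Alternating (M : PartialMap) : List Pair → Set where
      []   : Alternating M []
      link : ∀ {x y L} → Candidate L x → chosen M y ≡ true → cross x y ≡ true →
             Alternating M L → Alternating M ((x , y) ∷ L)

    unlink : ∀ {M x y L} → Alternating M ((x , y) ∷ L) →
             Candidate L x × chosen M y ≡ true × cross x y ≡ true × Alternating M L
    unlink (link cand cy xy alt) = cand , cy , xy , alt

    alternating-suffix : ∀ {M} D {L} → Alternating M (D ++ L) → Alternating M L
    alternating-suffix []            alt             = alt
    alternating-suffix ((x , y) ∷ D) (link _ _ _ alt) = alternating-suffix D alt

    undominated-suffix : ∀ D {L} u → dominated (D ++ L) u ≡ false → dominated L u ≡ false
    undominated-suffix []            u undom = undom
    undominated-suffix ((x , y) ∷ D) u undom =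
      undominated-suffix D u (proj₂ (proj₂ (undominated-cons x y (D ++ _) u undom)))

    undominated-firsts : ∀ L u → dominated L u ≡ false → All (λ q → cross (proj₁ q) u ≡ false) L
    undominated-firsts []            u _     = []
    undominated-firsts ((x , y) ∷ L) u undom with undominated-cons x y L u undom
    ... | xu , _ , rest = xu ∷ undominated-firsts L u rest

    chosen-not-r : ∀ M {y} → M r ≡ nothing → chosen M y ≡ true → part y ≢ r
    chosen-not-r M {y} free cy in-r
      with () ← trans (sym (chosen-sound M y cy)) (trans (cong M in-r) free)

    fresh-part : ∀ {M L x y} → M r ≡ nothing → Alternating M L → dominated L x ≡ false →
                 chosen M y ≡ true → cross x y ≡ true →
                 ∀ u → inParts L u ≡ true → part u ≢ part y
    fresh-part {M} free [] _ cy _ u in-r same =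
      chosen-not-r M free cy (trans (sym same) (does-true (part u ≟ r) in-r))
    fresh-part {M} {(x₂ , y₂) ∷ L} {x} {y} free (link _ cy₂ _ alt) undom cy xy u inL same
      with undominated-cons x₂ y₂ L x undom
         | ∨-split (does (part u ≟ part y₂)) (inParts L u) inL
    ... | _ , _ , undom' | inj₂ inL' = fresh-part free alt undom' cy xy u inL' same
    ... | _ , y₂x , _    | inj₁ at-y₂
      with chosen-unique M cy₂ cy (trans (sym (does-true (part u ≟ part y₂) at-y₂)) same)
    ...   | refl = contradictory (trans (cross-sym y x) xy) y₂x

    -- Each new
    -- pair (x , y) adds at most deg x + deg y dominated vertices but a fresh
    -- part of size greater than deg x + deg y.
    alternating-bound : ∀ {M L} → M r ≡ nothing → Alternating M L →
                        suc (length L + countV (dominated L)) ≤ countV (inParts L)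
    alternating-bound free [] with nonempty P r
    ... | v , in-r = count-strict (λ _ ()) (∈-allFin v) refl (dec-true (part v ≟ r) in-r)
    alternating-bound free (link {x} {y} {L} (_ , undom) cy xy alt) = begin
        suc (suc (length L) + countV (dominated ((x , y) ∷ L)))
      ≤⟨ s≤s (+-monoʳ-≤ (suc (length L)) dominated-growth) ⟩
        suc (suc (length L) + (deg x + (deg y + countV (dominated L))))
      ≡⟨ regroup (length L) (countV (dominated L)) (deg x) (deg y) ⟩
        suc (deg x + deg y) + suc (length L + countV (dominated L))
      ≤⟨ +-mono-≤ (haxell x y) (alternating-bound free alt) ⟩
        partSize P (part y) + countV (inParts L)
      ≡⟨ sym (count-∨-disjoint _ (inParts L) new-part (allFin n)) ⟩
        countV (inParts ((x , y) ∷ L)) ∎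
      where
        open ≤-Reasoning
        dominated-growth : countV (dominated ((x , y) ∷ L)) ≤ deg x + (deg y + countV (dominated L))
        dominated-growth = ≤-trans (count-∨ (cross x) _ (allFin n))
                             (+-monoʳ-≤ (deg x) (count-∨ (cross y) (dominated L) (allFin n)))
        new-part : ∀ u → does (part u ≟ part y) ≡ true → inParts L u ≡ false
        new-part u at-y with inParts L u in inL
        ... | false = refl
        ... | true  = ⊥-elim (fresh-part free alt undom cy xy u inL (does-true (part u ≟ part y) at-y))
        regroup : ∀ t d a c → suc (suc t + (a + (c + d))) ≡ suc (a + c) + suc (t + d)
        regroup = solve-∀

    sequence-short : ∀ {M L} → M r ≡ nothing → Alternating M L → suc (length L) ≤ n
    sequence-short {L = L} free alt =
      ≤-trans (m≤m+n (suc (length L)) _) (≤-trans (alternating-bound free alt) (countV≤n _))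

    candidate-exists : ∀ {M L} → M r ≡ nothing → Alternating M L → ∃ (Candidate L)
    candidate-exists {M} {L} free alt = u , candidate u good-u
      where
        good : Vertex → Bool
        good u = inParts L u ∧ not (dominated L u)
        candidate : ∀ u → good u ≡ true → Candidate L u
        candidate u g with inParts L u | dominated L u | g
        ... | true  | false | _  = refl , refl
        ... | true  | true  | ()
        ... | false | _     | ()
        good-or-dominated : ∀ u → inParts L u ≡ true → (good u ∨ dominated L u) ≡ true
        good-or-dominated u inL rewrite inL with dominated L u
        ... | true  = refl
        ... | false = refl
        bound : suc (length L) + countV (dominated L) ≤ countV good + countV (dominated L)
        bound = ≤-trans (alternating-bound free alt)
                  (≤-trans (count-mono good-or-dominated (allFin n)) (count-∨ good (dominated L) (allFin n)))
        witness : ∃ λ u → good u ≡ true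
        witness = count-witness good (allFin n)
                    (≤-trans (s≤s z≤n) (+-cancelʳ-≤ (countV (dominated L)) _ _ bound))
        u : Vertex
        u = proj₁ witness
        good-u : good u ≡ true
        good-u = proj₂ witness

    data InPartOf (u : Vertex) : List Pair → Set where
      at : ∀ D xj yj L₀ → part u ≡ part yj → InPartOf u (D ++ (xj , yj) ∷ L₀)

    locate : ∀ u L → inParts L u ≡ true → part u ≡ r ⊎ InPartOf u L
    locate u [] in-r = inj₁ (does-true (part u ≟ r) in-r)
    locate u ((x , y) ∷ L) inL with ∨-split (does (part u ≟ part y)) (inParts L u) inL
    ... | inj₁ at-y = inj₂ (at [] x y L (does-true (part u ≟ part y) at-y))
    ... | inj₂ inL' with locate u L inL'
    ...   | inj₁ in-r = inj₁ in-r
    ...   | inj₂ (at D xj yj L₀ same) = inj₂ (at ((x , y) ∷ D) xj yj L₀ same)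

    -- Placing x keeps a sequence alternating if the choice y' that x displaces
    -- is adjacent to a vertex z the sequence does not dominate (so y' is not in it).
    alternating-place : ∀ {M L x y' z} → chosen M y' ≡ true → part x ≡ part y' →
                        cross z y' ≡ true → dominated L z ≡ false →
                        Alternating M L → Alternating (place M x) L
    alternating-place cy' same zy' undom [] = []
    alternating-place {M} {x = x} {y'} {z} cy' same zy' undom (link {a} {y} {L} cand cy ay alt)
      with undominated-cons a y L z undom
    ... | _ , yz , undom' =
      link cand (chosen-place-keep M x y cy differ) ay (alternating-place cy' same zy' undom' alt)
      where
        differ : part y ≢ part x
        differ e with chosen-unique M cy cy' (trans e same)
        ... | refl = contradictory (trans (cross-sym y' z) zy') yz

    open Potential (suc n)

    pairDigit : PartialMap → Pair → ℕ
    pairDigit M q = mdeg M (proj₁ q)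

    digits : PartialMap → Vertex → List Pair → List ℕ
    digits M x L = mdeg M x ∷ map (pairDigit M) L

    weight : PartialMap → Vertex → List Pair → ℕ → ℕ
    weight M x L b = potential (digits M x L) b

    record Invariant (M : PartialMap) (L : List Pair) (x : Vertex) (b : ℕ) : Set where
      field
        partialIT   : IsPartialIT M
        r-free      : M r ≡ nothing
        extends     : Extends M₀ M
        alternating : Alternating M L
        candidate   : Candidate L x
        budget      : n ≤ length L + b

    Augmented : Set
    Augmented = Σ PartialMap λ M → IsPartialIT M × Extends M₀ M × Assigned M r

    record Successor (M : PartialMap) (L : List Pair) (x : Vertex) (b : ℕ) : Set where
      field
        M′        : PartialMap
        L′        : List Pair
        x′        : Vertex
        b′        : ℕ
        invariant : Invariant M′ L′ x′ b′
        smaller   : weight M′ x′ L′ b′ < weight M x L b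

    extend-step : ∀ {M L x b y} → Invariant M L x b → cross x y ≡ true → chosen M y ≡ true →
                  Successor M L x b
    extend-step {M} {L} {x} {b} {y} inv xy cy = grow b budget
      where
        open Invariant inv
        alternating' : Alternating M ((x , y) ∷ L)
        alternating' = link candidate cy xy alternating
        next : ∃ (Candidate ((x , y) ∷ L))
        next = candidate-exists r-free alternating'
        -- The budget cannot be exhausted: the longer sequence is still shorter than n.
        grow : ∀ b → n ≤ length L + b → Successor M L x b
        grow zero enough = ⊥-elim (1+n≰n (≤-trans (n≤1+n _)
          (≤-trans (sequence-short r-free alternating') (≤-trans enough (≤-reflexive (+-identityʳ _))))))
        grow (suc b) enough = record
          { M′ = M ; L′ = (x , y) ∷ L ; x′ = proj₁ next ; b′ = b
          ; invariant = record
              { partialIT = partialIT ; r-free = r-free ; extends = extends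
              ; alternating = alternating' ; candidate = proj₂ next
              ; budget = ≤-trans enough (≤-reflexive (+-suc (length L) b)) }
          ; smaller = potential-push (mdeg M (proj₁ next)) (digits M x L) b (s≤s (countV≤n _)) }

    -- The candidate x has no chosen neighbour and lies in the part of yⱼ:
    -- place x, displacing yⱼ, and cut the sequence back to xⱼ, whose M-degree drops.
    cut-step : ∀ {M D xj yj L₀ x b} → Invariant M (D ++ (xj , yj) ∷ L₀) x b →
               (∀ u → chosen M u ≡ true → cross x u ≡ false) → part x ≡ part yj →
               Successor M (D ++ (xj , yj) ∷ L₀) x b
    cut-step {M} {D} {xj} {yj} {L₀} {x} {b} inv isolated same = record
      { M′ = place M x ; L′ = L₀ ; x′ = xj ; b′ = b + length prefix
      ; invariant = record
          { partialIT = place-IsPartialIT x partialIT isolated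
          ; r-free = trans (place-off M x r r≢x) r-free
          ; extends = place-extends x extends
          ; alternating = alternating-place cyj same xjyj (proj₂ cand-xj) alt₀
          ; candidate = cand-xj
          ; budget = ≤-trans budget (≤-reflexive (trans (length-cut D (xj , yj) L₀ b)
                       (cong (λ t → length L₀ + (b + suc t)) (sym (length-map (pairDigit M) D))))) }
      ; smaller = subst (λ ds → weight (place M x) xj L₀ (b + length prefix) < potential ds b)
                    (sym digits-split) potential-drops }
      where
        open Invariant inv
        L : List Pair
        L = D ++ (xj , yj) ∷ L₀
        pieces : Candidate L₀ xj × chosen M yj ≡ true × cross xj yj ≡ true × Alternating M L₀
        pieces = unlink (alternating-suffix D alternating)
        cand-xj : Candidate L₀ xj
        cand-xj = proj₁ pieces
        cyj : chosen M yj ≡ true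
        cyj = proj₁ (proj₂ pieces)
        xjyj : cross xj yj ≡ true
        xjyj = proj₁ (proj₂ (proj₂ pieces))
        alt₀ : Alternating M L₀
        alt₀ = proj₂ (proj₂ (proj₂ pieces))
        r≢x : r ≢ part x
        r≢x r≡x = chosen-not-r M r-free cyj (trans (sym same) (sym r≡x))
        x-seen : cross xj x ≡ false × cross yj x ≡ false × dominated L₀ x ≡ false
        x-seen = undominated-cons xj yj L₀ x (undominated-suffix D x (proj₂ candidate))
        prefix : List ℕ
        prefix = mdeg M x ∷ map (pairDigit M) D
        digits-split : digits M x L ≡ prefix ++ digits M xj L₀
        digits-split = cong (mdeg M x ∷_) (map-++ (pairDigit M) D ((xj , yj) ∷ L₀))
        value-drops : value (digits (place M x) xj L₀) < value (digits M xj L₀)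
        value-drops = value-< {ds = map (pairDigit M) L₀} {ds' = map (pairDigit (place M x)) L₀}
          (mdeg-place-< M x xj yj (proj₁ x-seen) cyj xjyj (sym same))
          (value-mono (pairDigit (place M x)) (pairDigit M) L₀
            (All.map (λ {q} → mdeg-place-≤ M x (proj₁ q))
              (undominated-firsts L₀ x (proj₂ (proj₂ x-seen)))))
        potential-drops : weight (place M x) xj L₀ (b + length prefix) < potential (prefix ++ digits M xj L₀) b
        potential-drops = potential-cut prefix {digits M xj L₀} {digits (place M x) xj L₀} b value-drops
    swap-step : ∀ {M L x b} → Invariant M L x b → (∀ u → chosen M u ≡ true → cross x u ≡ false) →
                Augmented ⊎ Successor M L x b
    swap-step {M} {L} {x} inv isolated with locate x L (proj₁ (Invariant.candidate inv))
    ... | inj₁ in-r = inj₁ (place M x , place-IsPartialIT x (Invariant.partialIT inv) isolated ,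
                            place-extends x (Invariant.extends inv) ,
                            x , subst (λ i → place M x i ≡ just x) in-r (place-at M x))
    ... | inj₂ (at D xj yj L₀ same) = inj₂ (cut-step inv isolated same)

    step : ∀ {M L x b} → Invariant M L x b → Augmented ⊎ Successor M L x b
    step {M} {L} {x} inv with mdeg M x in mdeg-x
    ... | zero  = swap-step inv (mdeg-zero M x mdeg-x)
    ... | suc _ with count-witness (λ u → cross x u ∧ chosen M u) (allFin n)
                       (subst (0 <_) (sym mdeg-x) (s≤s z≤n))
    ...   | y , xy∧cy with ∧-split (cross x y) (chosen M y) xy∧cy
    ...     | xy , cy = inj₂ (extend-step inv xy cy)

    run : ∀ {M L x b} → Invariant M L x b → Acc _<_ (weight M x L b) → Augmented
    run inv (acc smaller-accessible) with step inv
    ... | inj₁ done = done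
    ... | inj₂ next = run (Successor.invariant next) (smaller-accessible (Successor.smaller next))

    augment : IsPartialIT M₀ → M₀ r ≡ nothing → Augmented
    augment pit free with nonempty P r
    ... | v , in-r = run start (<-wellFounded _)
      where
        start : Invariant M₀ [] v n
        start = record
          { partialIT = pit ; r-free = free ; extends = λ _ assigned → assigned
          ; alternating = [] ; candidate = dec-true (part v ≟ r) in-r , refl ; budget = ≤-refl }

  cover-parts : HaxellCondition → ∀ I → Σ PartialMap λ M → IsPartialIT M × All (Assigned M) I
  cover-parts haxell [] = emptyMap , empty-IsPartialIT , []
  cover-parts haxell (i ∷ I) with cover-parts haxell I
  ... | M , pit , assigned with M i in Mi
  ...   | just w  = M , pit , (w , Mi) ∷ assigned
  ...   | nothing with Augmentation.augment haxell i M pit Mi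
  ...     | M' , pit' , ext , assigned-i = M' , pit' , assigned-i ∷ All.map (λ {j} → ext j) assigned

  independent-transversal : HaxellCondition → IndependentTransversal G P
  independent-transversal haxell with cover-parts haxell (allFin m)
  ... | M , pit , assigned = pick , pick-part , pick-independent
    where
      assigned-at : ∀ i → Assigned M i
      assigned-at i = All.lookup assigned (∈-allFin i)
      pick : Fin m → Vertex
      pick i = proj₁ (assigned-at i)
      pick-part : ∀ i → part (pick i) ≡ i
      pick-part i = IsPartialIT.inPart pit i (pick i) (proj₂ (assigned-at i))
      pick-chosen : ∀ i → chosen M (pick i) ≡ true
      pick-chosen i = chosen-complete M (pick i) (trans (cong M (pick-part i)) (proj₂ (assigned-at i)))
      pick-independent : ∀ i j → adj G (pick i) (pick j) ≡ false
      pick-independent i j with i ≟ j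
      ... | yes refl = irrefl G (pick i)
      ... | no i≢j = cross-false (pick i) (pick j)
                       (IsPartialIT.independent pit _ _ (pick-chosen i) (pick-chosen j))
                       (λ e → i≢j (trans (sym (pick-part i)) (trans (sym e) (pick-part j))))

lemma8 : (k : ℕ) → 1 ≤ k → (n m : ℕ) → (G : Graph n) → (P : Partition n m) →
    (∀ v → (outDeg G P v + 1 ≤ k) × (outDeg G P v + k ≤ partSize P (cls P v))) →
    IndependentTransversal G P
lemma8 k _ n m G P hyp = independent-transversal haxell
  where
    open Transversals G P
    open ≤-Reasoning
    haxell : HaxellCondition
    haxell x y = begin
      suc (deg x) + deg y   ≡⟨ cong (_+ deg y) (+-comm 1 (deg x)) ⟩
      deg x + 1 + deg y     ≤⟨ +-monoˡ-≤ (deg y) (proj₁ (hyp x)) ⟩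
      k + deg y             ≡⟨ +-comm k (deg y) ⟩
      deg y + k             ≤⟨ proj₂ (hyp y) ⟩
      partSize P (part y)   ∎
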